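{- Fix numbers $\Delta\geq c>0$. Let $\mathcal{G}$ be a graph class closed under minors and disjoint unions, such that $|E(H)|<c|V(H)|$ for every graph $H\in\mathcal{G}$. Let $S$ be any star and $H$ be any graph in $\mathcal{G}$. Let $G$ be any graph with maximum degree $\Delta$ that is a minor of $S \cdot H$. Then $$|E(G)|< c|V(G)|+(\Delta-c)\,|V(H)|.$$
   Context: $G_1\cdot G_2$ denotes the lexicographic product: vertex set $V(G_1)\times V(G_2)$, where distinct $(u_1,u_2),(v_1,v_2)$ are adjacent iff $u_1v_1\in E(G_1)$, or $u_1=v_1$ and $u_2v_2\in E(G_2)$.
   Formalization: The constant c is taken in the rationals. -}

module Defs where

open import Data.Bool using (Bool; true; false; _∨_; _∧_; if_then_else_)
open import Data.Nat using (ℕ; zero; suc; _+_; _*_)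
open import Data.Fin using (Fin; zero; suc; toℕ; splitAt; remQuot; _≟_; _<?_)
open import Data.List using (List; []; _∷_; map; allFin)
open import Data.Nat.ListAction using (sum)
open import Data.Maybe using (Maybe; just; nothing)
open import Data.Product using (Σ; ∃; _×_; _,_; proj₁; proj₂)
open import Data.Sum using (inj₁; inj₂)
open import Data.Integer using (+_)
open import Data.Rational using (ℚ; _/_)
open import Relation.Nullary using (yes; no; ¬_)
open import Relation.Nullary.Decidable using (⌊_⌋)
open import Relation.Binary.PropositionalEquality using (_≡_; refl; sym; trans; cong)

record Graph : Set where
  field
    n     : ℕ
    adj   : Fin n → Fin n → Bool
    adj-sym : ∀ x y → adj x y ≡ adj y x
    adj-irr : ∀ x → adj x x ≡ false

open Graph public

∣V∣ : Graph → ℕ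
∣V∣ G = n G

[_] : Bool → ℕ
[ true ]  = 1
[ false ] = 0

deg : (G : Graph) → Fin (n G) → ℕ
deg G x = sum (map (λ y → [ adj G x y ]) (allFin (n G)))

∣E∣ : Graph → ℕ
∣E∣ G = sum (map (λ x → sum (map (λ y → [ ⌊ x <? y ⌋ ∧ adj G x y ]) (allFin (n G))))
                 (allFin (n G)))

MaxDegree : Graph → ℕ → Set
MaxDegree G Δ = (∀ x → deg G x Data.Nat.≤ Δ) × (∃ λ x → deg G x ≡ Δ)

-- walk from x to z in G all of whose vertices after x satisfy P
data Walk (G : Graph) (P : Fin (n G) → Set) : Fin (n G) → Fin (n G) → Set where
  here : ∀ {x} → Walk G P x x
  step : ∀ {x y z} → adj G x y ≡ true → P y → Walk G P y z → Walk G P x z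

-- M is a minor of G: a map assigning vertices of G to branch sets
-- (or to nothing = deleted), each branch set nonempty and connected,
-- and every edge of M realised by an edge of G between the branch sets.
record MinorModel (M G : Graph) : Set where
  field
    branch    : Fin (n G) → Maybe (Fin (n M))
    nonempty  : ∀ v → ∃ λ x → branch x ≡ just v
    connected : ∀ v x y → branch x ≡ just v → branch y ≡ just v →
                Walk G (λ z → branch z ≡ just v) x y
    edges     : ∀ u v → adj M u v ≡ true →
                ∃ λ x → ∃ λ y → branch x ≡ just u × branch y ≡ just v × adj G x y ≡ true

_≼_ : Graph → Graph → Set
M ≼ G = MinorModel M G

private
  ∨-comm : ∀ a b → (a ∨ b) ≡ (b ∨ a)
  ∨-comm false false = refl
  ∨-comm false true  = refl
  ∨-comm true  false = refl
  ∨-comm true  true  = refl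

  ∧-comm : ∀ a b → (a ∧ b) ≡ (b ∧ a)
  ∧-comm false false = refl
  ∧-comm false true  = refl
  ∧-comm true  false = refl
  ∧-comm true  true  = refl

⊕adj : (G H : Graph) → Fin (n G + n H) → Fin (n G + n H) → Bool
⊕adj G H i j with splitAt (n G) i | splitAt (n G) j
... | inj₁ a | inj₁ b = adj G a b
... | inj₂ a | inj₂ b = adj H a b
... | inj₁ _ | inj₂ _ = false
... | inj₂ _ | inj₁ _ = false

⊕sym : (G H : Graph) → ∀ i j → ⊕adj G H i j ≡ ⊕adj G H j i
⊕sym G H i j with splitAt (n G) i | splitAt (n G) j
... | inj₁ a | inj₁ b = adj-sym G a b
... | inj₂ a | inj₂ b = adj-sym H a b
... | inj₁ _ | inj₂ _ = refl
... | inj₂ _ | inj₁ _ = refl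

⊕irr : (G H : Graph) → ∀ i → ⊕adj G H i i ≡ false
⊕irr G H i with splitAt (n G) i
... | inj₁ a = adj-irr G a
... | inj₂ a = adj-irr H a

_⊕_ : Graph → Graph → Graph
G ⊕ H = record { n = n G + n H ; adj = ⊕adj G H ; adj-sym = ⊕sym G H ; adj-irr = ⊕irr G H }

starAdj : ∀ s → Fin (suc s) → Fin (suc s) → Bool
starAdj s zero    zero    = false
starAdj s zero    (suc _) = true
starAdj s (suc _) zero    = true
starAdj s (suc _) (suc _) = false

Star : ℕ → Graph
Star s = record
  { n = suc s ; adj = starAdj s
  ; adj-sym = λ { zero zero → refl ; zero (suc _) → refl ; (suc _) zero → refl ; (suc _) (suc _) → refl }
  ; adj-irr = λ { zero → refl ; (suc _) → refl } }

-- Lexicographic product G₁ · G₂ on Fin (n G₁ * n G₂) ≅ Fin (n G₁) × Fin (n G₂):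
-- (u₁,u₂) ~ (v₁,v₂) iff u₁v₁ ∈ E(G₁), or u₁ = v₁ and u₂v₂ ∈ E(G₂).

private
  ≟-sym : ∀ {k} (a b : Fin k) → ⌊ a ≟ b ⌋ ≡ ⌊ b ≟ a ⌋
  ≟-sym a b with a ≟ b | b ≟ a
  ... | yes _ | yes _ = refl
  ... | no _  | no _  = refl
  ... | yes p | no q  with q (sym p)
  ... | ()
  ≟-sym a b | no p | yes q with p (sym q)
  ... | ()

  ≟-refl : ∀ {k} (a : Fin k) → ⌊ a ≟ a ⌋ ≡ true
  ≟-refl a with a ≟ a
  ... | yes _ = refl
  ... | no p with p refl
  ... | ()

lexAdjP : (G₁ G₂ : Graph) → Fin (n G₁) × Fin (n G₂) → Fin (n G₁) × Fin (n G₂) → Bool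
lexAdjP G₁ G₂ (u₁ , u₂) (v₁ , v₂) = adj G₁ u₁ v₁ ∨ (⌊ u₁ ≟ v₁ ⌋ ∧ adj G₂ u₂ v₂)

lexSymP : (G₁ G₂ : Graph) → ∀ p q → lexAdjP G₁ G₂ p q ≡ lexAdjP G₁ G₂ q p
lexSymP G₁ G₂ (u₁ , u₂) (v₁ , v₂)
  rewrite adj-sym G₁ u₁ v₁ | ≟-sym u₁ v₁ | adj-sym G₂ u₂ v₂ = refl

lexIrrP : (G₁ G₂ : Graph) → ∀ p → lexAdjP G₁ G₂ p p ≡ false
lexIrrP G₁ G₂ (u₁ , u₂) rewrite adj-irr G₁ u₁ | ≟-refl u₁ | adj-irr G₂ u₂ = refl

_·_ : Graph → Graph → Graph
G₁ · G₂ = record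
  { n = n G₁ * n G₂
  ; adj = λ i j → lexAdjP G₁ G₂ (remQuot (n G₂) i) (remQuot (n G₂) j)
  ; adj-sym = λ i j → lexSymP G₁ G₂ (remQuot (n G₂) i) (remQuot (n G₂) j)
  ; adj-irr = λ i → lexIrrP G₁ G₂ (remQuot (n G₂) i) }

GraphClass : Set₁
GraphClass = Graph → Set

MinorClosed : GraphClass → Set
MinorClosed 𝒢 = ∀ M G → 𝒢 G → M ≼ G → 𝒢 M

UnionClosed : GraphClass → Set
UnionClosed 𝒢 = ∀ G H → 𝒢 G → 𝒢 H → 𝒢 (G ⊕ H)

ℕ→ℚ : ℕ → ℚ
ℕ→ℚ k = (+ k) / 1

-- Fix a minor model φ of G in Star s · H and let m be the number of vertices of the copy of H at
-- the centre of the star that lie in branch sets of φ; as m ≤ |V(H)| it suffices to show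
-- |E(G)| < c |V(G)| + (Δ − c) m, by induction on |V(G)|. If no branch set meets the centre copy,
-- φ lives in the s leaf copies of H, which are pairwise non-adjacent, so G is a minor of a disjoint
-- union of copies of H, lies in 𝒢 and has fewer than c |V(G)| edges. Otherwise delete a vertex v of
-- G whose branch set meets the centre copy: G − v is a minor of Star s · H using fewer centre
-- vertices, and the at most Δ edges lost with v are paid for by c + (Δ − c) = Δ.

module Submission where

open import Defs
open import Data.Bool using (Bool; true; false; _∧_)
open import Data.Nat as ℕ using (ℕ; zero; suc; _+_; _≤_; _<_; z≤n; s≤s)
import Data.Nat.Properties as ℕ
import Data.Nat.Coprimality as Coprime
import Data.Nat.ListAction as List
open import Data.Integer as ℤ using (+≤+; +<+)
import Data.Integer.Properties as ℤ
open import Data.Rational as ℚ using (ℚ; 0ℚ; 1ℚ; mkℚ; *≤*; *<*; _-_)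
import Data.Rational.Properties as ℚ
import Data.Rational.Solver as ℚ-Solver
open import Data.Nat.Solver using (module +-*-Solver)
open import Data.Fin as Fin using (Fin; zero; suc; punchIn; punchOut; _↑ˡ_; _↑ʳ_; splitAt; quotRem; _≟_; _<?_)
import Data.Fin.Properties as Fin
open import Data.List using (map; allFin; tabulate)
import Data.List.Properties as List
open import Data.Maybe using (Maybe; just; nothing; is-just; _>>=_)
import Data.Maybe.Properties as Maybe
open import Data.Product using (∃; _×_; _,_; map₂; swap)
open import Data.Sum using (_⊎_; inj₁; inj₂)
open import Algebra.Properties.CommutativeMonoid.Sum ℕ.+-0-commutativeMonoid
  using (sum-syntax; sum-remove; ∑-distrib-+; sum-cong-≗) renaming (sum to ∑)
open import Function using (_∘_; _⇔_; mk⇔)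
open import Relation.Binary.Definitions using (tri<; tri≈; tri>)
open import Relation.Binary.PropositionalEquality
  using (_≡_; _≢_; refl; sym; trans; cong; cong₂; subst; subst₂; module ≡-Reasoning)
open import Relation.Nullary using (Dec; ¬_; yes; no; contradiction)
open import Relation.Nullary.Decidable using (⌊_⌋; isYes≗does; dec-true; dec-false; does-⇔)

ℕ→ℚ≡mkℚ : ∀ k → ℕ→ℚ k ≡ mkℚ (ℤ.+ k) 0 (Coprime.sym (Coprime.1-coprimeTo k))
ℕ→ℚ≡mkℚ k = ℚ.normalize-coprime _

ℕ→ℚ-homo-+ : ∀ a b → ℕ→ℚ (a + b) ≡ ℕ→ℚ a ℚ.+ ℕ→ℚ b
ℕ→ℚ-homo-+ a b
  rewrite ℕ→ℚ≡mkℚ a | ℕ→ℚ≡mkℚ b | ℤ.*-identityʳ (ℤ.+ a) | ℤ.*-identityʳ (ℤ.+ b) = refl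

ℕ→ℚ-mono-≤ : ∀ {a b} → a ≤ b → ℕ→ℚ a ℚ.≤ ℕ→ℚ b
ℕ→ℚ-mono-≤ {a} {b} a≤b rewrite ℕ→ℚ≡mkℚ a | ℕ→ℚ≡mkℚ b =
  *≤* (subst₂ ℤ._≤_ (sym (ℤ.*-identityʳ (ℤ.+ a))) (sym (ℤ.*-identityʳ (ℤ.+ b))) (+≤+ a≤b))

ℕ→ℚ-mono-< : ∀ {a b} → a < b → ℕ→ℚ a ℚ.< ℕ→ℚ b
ℕ→ℚ-mono-< {a} {b} a<b rewrite ℕ→ℚ≡mkℚ a | ℕ→ℚ≡mkℚ b =
  *<* (subst₂ ℤ._<_ (sym (ℤ.*-identityʳ (ℤ.+ a))) (sym (ℤ.*-identityʳ (ℤ.+ b))) (+<+ a<b))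

sum-tabulate : ∀ {m} (f : Fin m → ℕ) → List.sum (tabulate f) ≡ ∑ f
sum-tabulate {zero}  f = refl
sum-tabulate {suc m} f = cong (f zero +_) (sum-tabulate (f ∘ suc))

sum-map-allFin : ∀ {m} (f : Fin m → ℕ) → List.sum (map f (allFin m)) ≡ ∑ f
sum-map-allFin f = trans (cong List.sum (List.map-tabulate (λ i → i) f)) (sum-tabulate f)

∑-mono-≤ : ∀ {m} {f g : Fin m → ℕ} → (∀ i → f i ≤ g i) → ∑ f ≤ ∑ g
∑-mono-≤ {zero}  f≤g = z≤n
∑-mono-≤ {suc m} f≤g = ℕ.+-mono-≤ (f≤g zero) (∑-mono-≤ (f≤g ∘ suc))

∑-mono-< : ∀ {m} {f g : Fin m → ℕ} → (∀ i → f i ≤ g i) → ∀ x → f x < g x → ∑ f < ∑ g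
∑-mono-< f≤g zero    fx<gx = ℕ.+-mono-<-≤ fx<gx (∑-mono-≤ (f≤g ∘ suc))
∑-mono-< f≤g (suc x) fx<gx = ℕ.+-mono-≤-< (f≤g zero) (∑-mono-< (f≤g ∘ suc) x fx<gx)

∑-count-≤ : ∀ {m} (b : Fin m → Bool) → ∑[ i < m ] [ b i ] ≤ m
∑-count-≤ {zero}  b = z≤n
∑-count-≤ {suc m} b with b zero
... | true  = s≤s (∑-count-≤ (b ∘ suc))
... | false = ℕ.m≤n⇒m≤1+n (∑-count-≤ (b ∘ suc))

∑∑-remove : ∀ {k} (f : Fin (suc k) → Fin (suc k) → ℕ) (v : Fin (suc k)) →
  ∑[ x < suc k ] ∑[ y < suc k ] f x y ≡
  ∑[ i < k ] ∑[ j < k ] f (punchIn v i) (punchIn v j)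
    + (f v v + ∑[ j < k ] (f v (punchIn v j) + f (punchIn v j) v))
∑∑-remove f v = begin
  ∑[ x < _ ] ∑[ y < _ ] f x y
    ≡⟨ sum-remove {i = v} (λ x → ∑[ y < _ ] f x y) ⟩
  ∑[ y < _ ] f v y + ∑[ i < _ ] ∑[ y < _ ] f (punchIn v i) y
    ≡⟨ cong₂ _+_ (sum-remove {i = v} (f v)) (sum-cong-≗ (λ i → sum-remove {i = v} (f (punchIn v i)))) ⟩
  (f v v + row) + ∑[ i < _ ] (f (punchIn v i) v + ∑[ j < _ ] f (punchIn v i) (punchIn v j))
    ≡⟨ cong ((f v v + row) +_) (∑-distrib-+ (λ i → f (punchIn v i) v) _) ⟩
  (f v v + row) + (column + rest)
    ≡⟨ rearrange (f v v) row column rest ⟩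
  rest + (f v v + (row + column))
    ≡⟨ cong (λ t → rest + (f v v + t)) (∑-distrib-+ (f v ∘ punchIn v) (λ j → f (punchIn v j) v)) ⟨
  rest + (f v v + ∑[ j < _ ] (f v (punchIn v j) + f (punchIn v j) v)) ∎
  where
  open ≡-Reasoning
  open +-*-Solver
  row    = ∑[ j < _ ] f v (punchIn v j)
  column = ∑[ i < _ ] f (punchIn v i) v
  rest   = ∑[ i < _ ] ∑[ j < _ ] f (punchIn v i) (punchIn v j)
  rearrange : ∀ a b c d → (a + b) + (c + d) ≡ d + (a + (b + c))
  rearrange = solve 4 (λ a b c d → (a :+ b) :+ (c :+ d) := d :+ (a :+ (b :+ c))) refl

all-nothing-or-just : ∀ {m} {A : Set} (f : Fin m → Maybe A) →
  (∀ x → f x ≡ nothing) ⊎ (∃ λ x → ∃ λ a → f x ≡ just a)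
all-nothing-or-just {zero}  f = inj₁ λ ()
all-nothing-or-just {suc m} f with f zero in f0≡ | all-nothing-or-just (f ∘ suc)
... | just a  | _                  = inj₂ (zero , a , f0≡)
... | nothing | inj₁ rest          = inj₁ λ { zero → f0≡ ; (suc x) → rest x }
... | nothing | inj₂ (x , a , fx≡) = inj₂ (suc x , a , fx≡)

⌊⌋-true : ∀ {A : Set} (a? : Dec A) → A → ⌊ a? ⌋ ≡ true
⌊⌋-true a? a = trans (isYes≗does a?) (dec-true a? a)

⌊⌋-false : ∀ {A : Set} (a? : Dec A) → ¬ A → ⌊ a? ⌋ ≡ false
⌊⌋-false a? ¬a = trans (isYes≗does a?) (dec-false a? ¬a)

⌊⌋-⇔ : ∀ {A B : Set} → A ⇔ B → (a? : Dec A) (b? : Dec B) → ⌊ a? ⌋ ≡ ⌊ b? ⌋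
⌊⌋-⇔ A⇔B a? b? = trans (isYes≗does a?) (trans (does-⇔ A⇔B a? b?) (sym (isYes≗does b?)))

deg≡∑ : ∀ G x → deg G x ≡ ∑[ y < n G ] [ adj G x y ]
deg≡∑ G x = sum-map-allFin (λ y → [ adj G x y ])

∣E∣≡∑∑ : ∀ G → ∣E∣ G ≡ ∑[ x < n G ] ∑[ y < n G ] [ ⌊ x <? y ⌋ ∧ adj G x y ]
∣E∣≡∑∑ G = trans (sum-map-allFin (λ x → List.sum (map (e x) (allFin (n G)))))
                 (sum-cong-≗ (λ x → sum-map-allFin (e x)))
  where e = λ x y → [ ⌊ x <? y ⌋ ∧ adj G x y ]

punchIn-<-⇔ : ∀ {k} (v : Fin (suc k)) (i j : Fin k) → punchIn v i Fin.< punchIn v j ⇔ i Fin.< j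
punchIn-<-⇔ v i j = mk⇔
  (λ lt → ℕ.≰⇒> (λ j≤i → ℕ.<⇒≱ lt (Fin.punchIn-mono-≤ v j i j≤i)))
  (λ lt → ℕ.≰⇒> (λ pj≤pi → ℕ.<⇒≱ lt (Fin.punchIn-cancel-≤ v j i pj≤pi)))

[<∧]+[>∧] : ∀ {m} {x y : Fin m} → x ≢ y → ∀ b →
  [ ⌊ x <? y ⌋ ∧ b ] + [ ⌊ y <? x ⌋ ∧ b ] ≡ [ b ]
[<∧]+[>∧] {x = x} {y} x≢y b with Fin.<-cmp x y
... | tri< x<y _ y≮x rewrite ⌊⌋-true (x <? y) x<y | ⌊⌋-false (y <? x) y≮x = ℕ.+-identityʳ [ b ]
... | tri≈ _ x≡y _   = contradiction x≡y x≢y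
... | tri> x≮y _ y<x rewrite ⌊⌋-false (x <? y) x≮y | ⌊⌋-true (y <? x) y<x = refl

_∖_ : (G : Graph) → Fin (n G) → Graph
record { n = suc k ; adj = a ; adj-sym = sym-a ; adj-irr = irr-a } ∖ v = record
  { n = k
  ; adj = λ x y → a (punchIn v x) (punchIn v y)
  ; adj-sym = λ x y → sym-a (punchIn v x) (punchIn v y)
  ; adj-irr = irr-a ∘ punchIn v
  }

∣V∣-∖ : ∀ G v → suc (∣V∣ (G ∖ v)) ≡ ∣V∣ G
∣V∣-∖ record { n = suc k } v = refl

deg-∖-≤ : ∀ {Δ} G v → (∀ x → deg G x ≤ Δ) → ∀ x → deg (G ∖ v) x ≤ Δ
deg-∖-≤ G@record { n = suc k } v deg≤Δ x = ℕ.≤-trans deg∖v≤deg (deg≤Δ (punchIn v x))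
  where
  open ℕ.≤-Reasoning
  deg∖v≤deg : deg (G ∖ v) x ≤ deg G (punchIn v x)
  deg∖v≤deg = begin
    deg (G ∖ v) x
      ≡⟨ deg≡∑ (G ∖ v) x ⟩
    ∑[ j < k ] [ adj G (punchIn v x) (punchIn v j) ]
      ≤⟨ ℕ.m≤n+m _ _ ⟩
    [ adj G (punchIn v x) v ] + ∑[ j < k ] [ adj G (punchIn v x) (punchIn v j) ]
      ≡⟨ sum-remove {i = v} (λ y → [ adj G (punchIn v x) y ]) ⟨
    ∑[ y < suc k ] [ adj G (punchIn v x) y ]
      ≡⟨ deg≡∑ G (punchIn v x) ⟨
    deg G (punchIn v x) ∎

∣E∣-∖ : ∀ G v → ∣E∣ G ≡ ∣E∣ (G ∖ v) + deg G v
∣E∣-∖ G@record { n = suc k } v = begin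
  ∣E∣ G                                  ≡⟨ ∣E∣≡∑∑ G ⟩
  ∑[ x < suc k ] ∑[ y < suc k ] e x y    ≡⟨ ∑∑-remove e v ⟩
  ∑[ i < k ] ∑[ j < k ] e (punchIn v i) (punchIn v j)
    + (e v v + ∑[ j < k ] (e v (punchIn v j) + e (punchIn v j) v))
    ≡⟨ cong₂ _+_ (sum-cong-≗ λ i → sum-cong-≗ (e-punchIn i)) (cong₂ _+_ e-irr (sum-cong-≗ e-sym)) ⟩
  ∑[ i < k ] ∑[ j < k ] [ ⌊ i <? j ⌋ ∧ adj (G ∖ v) i j ] + ∑[ j < k ] [ adj G v (punchIn v j) ]
    ≡⟨ cong₂ _+_ (∣E∣≡∑∑ (G ∖ v)) deg-v ⟨
  ∣E∣ (G ∖ v) + deg G v                  ∎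
  where
  open ≡-Reasoning
  e : Fin (suc k) → Fin (suc k) → ℕ
  e x y = [ ⌊ x <? y ⌋ ∧ adj G x y ]

  e-irr : e v v ≡ 0
  e-irr = cong (λ p → [ p ∧ adj G v v ]) (⌊⌋-false (v <? v) (Fin.<-irrefl refl))

  e-sym : ∀ j → e v (punchIn v j) + e (punchIn v j) v ≡ [ adj G v (punchIn v j) ]
  e-sym j rewrite adj-sym G (punchIn v j) v =
    [<∧]+[>∧] (Fin.punchInᵢ≢i v j ∘ sym) (adj G v (punchIn v j))

  e-punchIn : ∀ i j → e (punchIn v i) (punchIn v j) ≡ [ ⌊ i <? j ⌋ ∧ adj (G ∖ v) i j ]
  e-punchIn i j = cong (λ p → [ p ∧ adj (G ∖ v) i j ])
    (⌊⌋-⇔ (punchIn-<-⇔ v i j) (punchIn v i <? punchIn v j) (i <? j))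

  deg-v : deg G v ≡ ∑[ j < k ] [ adj G v (punchIn v j) ]
  deg-v rewrite deg≡∑ G v | sum-remove {i = v} (λ y → [ adj G v y ]) | adj-irr G v = refl

∣V∣≡1⇒∣E∣≡0 : ∀ G → ∣V∣ G ≡ 1 → ∣E∣ G ≡ 0
∣V∣≡1⇒∣E∣≡0 record { n = suc zero } refl = refl

Walk-map : ∀ {G} {P Q : Fin (n G) → Set} → (∀ {z} → P z → Q z) →
  ∀ {x y} → Walk G P x y → Walk G Q x y
Walk-map P⇒Q here           = here
Walk-map P⇒Q (step e Py w) = step e (P⇒Q Py) (Walk-map P⇒Q w)

≼-refl : ∀ {G} → G ≼ G
≼-refl = record
  { branch    = just
  ; nonempty  = λ v → v , refl
  ; connected = λ v x y x≡v y≡v →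
      subst (Walk _ _ x) (Maybe.just-injective (trans x≡v (sym y≡v))) here
  ; edges     = λ u v uv → u , v , refl , refl , uv
  }

module _ {G K L : Graph} (φ : G ≼ K) (ι : Fin (n L) → Fin (n K))
         (ι-injective : ∀ {i j} → ι i ≡ ι j → i ≡ j)
         (ι-adj : ∀ i j → adj L i j ≡ adj K (ι i) (ι j))
         (ι-covers : ∀ y {v} → MinorModel.branch φ y ≡ just v → ∃ λ i → ι i ≡ y) where

  open MinorModel φ

  private
    pullWalk : ∀ {v a b} → Walk K (λ z → branch z ≡ just v) a b →
               ∀ {i j} → ι i ≡ a → ι j ≡ b → Walk L (λ z → branch (ι z) ≡ just v) i j
    pullWalk here ιi≡a ιj≡a = subst (Walk L _ _) (ι-injective (trans ιi≡a (sym ιj≡a))) here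
    pullWalk (step ab b∈v w) refl ιj≡c with ι-covers _ b∈v
    ... | l , refl = step (trans (ι-adj _ l) ab) b∈v (pullWalk w refl ιj≡c)

  ≼-restrict : G ≼ L
  ≼-restrict = record
    { branch    = branch ∘ ι
    ; nonempty  = λ v → let x , x∈v = nonempty v ; i , ιi≡x = ι-covers x x∈v in
        i , trans (cong branch ιi≡x) x∈v
    ; connected = λ v i j i∈v j∈v → pullWalk (connected v (ι i) (ι j) i∈v j∈v) refl refl
    ; edges     = λ u v uv → let x , y , x∈u , y∈v , xy = edges u v uv
                                 i , ιi≡x = ι-covers x x∈u ; j , ιj≡y = ι-covers y y∈v in
        i , j , trans (cong branch ιi≡x) x∈u , trans (cong branch ιj≡y) y∈v ,
        trans (ι-adj i j) (subst₂ (λ p q → adj K p q ≡ true) (sym ιi≡x) (sym ιj≡y) xy)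
    }

punchOut? : ∀ {k} → Fin (suc k) → Fin (suc k) → Maybe (Fin k)
punchOut? v w with v ≟ w
... | yes _   = nothing
... | no v≢w = just (punchOut v≢w)

punchOut?-self : ∀ {k} (v : Fin (suc k)) → punchOut? v v ≡ nothing
punchOut?-self v with v ≟ v
... | yes _   = refl
... | no v≢v = contradiction refl v≢v

punchOut?-punchIn : ∀ {k} (v : Fin (suc k)) w → punchOut? v (punchIn v w) ≡ just w
punchOut?-punchIn v w with v ≟ punchIn v w
... | yes v≡w = contradiction (sym v≡w) (Fin.punchInᵢ≢i v w)
... | no v≢w = cong just (trans (Fin.punchOut-cong v refl) (Fin.punchOut-punchIn v))

punchOut?≡just : ∀ {k} (v w : Fin (suc k)) {w′} → punchOut? v w ≡ just w′ → w ≡ punchIn v w′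
punchOut?≡just v w eq with v ≟ w
punchOut?≡just v w ()   | yes _
punchOut?≡just v w refl | no v≢w = sym (Fin.punchIn-punchOut v≢w)

_∖ᴹ_ : ∀ {G K} → G ≼ K → (v : Fin (n G)) → (G ∖ v) ≼ K
_∖ᴹ_ {G = record { n = suc k }} φ v = record
  { branch    = λ y → branch y >>= punchOut? v
  ; nonempty  = λ w → let x , x∈w = nonempty (punchIn v w) in x , drop-just x∈w
  ; connected = λ w x y x∈w y∈w →
      Walk-map drop-just (connected (punchIn v w) x y (just-drop x∈w) (just-drop y∈w))
  ; edges     = λ u w uw → let x , y , x∈u , y∈w , xy = edges (punchIn v u) (punchIn v w) uw in
      x , y , drop-just x∈u , drop-just y∈w , xy
  }
  where
  open MinorModel φ
  drop-just : ∀ {y w} → branch y ≡ just (punchIn v w) → (branch y >>= punchOut? v) ≡ just w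
  drop-just {w = w} y∈w = trans (cong (_>>= punchOut? v) y∈w) (punchOut?-punchIn v w)
  just-drop : ∀ {y w} → (branch y >>= punchOut? v) ≡ just w → branch y ≡ just (punchIn v w)
  just-drop {y} eq with branch y
  ... | just u = cong just (punchOut?≡just v u eq)

branched : ∀ {G K m} → G ≼ K → (Fin m → Fin (n K)) → ℕ
branched {m = m} φ ι = ∑[ i < m ] [ is-just (MinorModel.branch φ (ι i)) ]

branched-∖ᴹ : ∀ {G K m} (φ : G ≼ K) (ι : Fin m → Fin (n K)) {v} i →
  MinorModel.branch φ (ι i) ≡ just v → branched (φ ∖ᴹ v) ι < branched φ ι
branched-∖ᴹ {G = record { n = suc k }} φ ι {v} i ιi∈v =
  ∑-mono-< (λ j → drop-≤ (branch (ι j))) i drop-<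
  where
  open MinorModel φ
  drop-< : [ is-just (branch (ι i) >>= punchOut? v) ] < [ is-just (branch (ι i)) ]
  drop-< rewrite ιi∈v | punchOut?-self v = s≤s z≤n
  drop-≤ : ∀ b → [ is-just (b >>= punchOut? v) ] ≤ [ is-just b ]
  drop-≤ nothing = z≤n
  drop-≤ (just w) with v ≟ w
  ... | yes _ = z≤n
  ... | no _  = s≤s z≤n

-- Edgeless s · H is the disjoint union of s copies of H.
Edgeless : ℕ → Graph
Edgeless s = record { n = s ; adj = λ _ _ → false ; adj-sym = λ _ _ → refl ; adj-irr = λ _ → refl }

-- remQuot puts the copy of H at the centre of Star s · H in its first n H vertices and the s leaf
-- copies, which induce Edgeless s · H, after them.
centre : ∀ s H → Fin (n H) → Fin (n (Star s · H))
centre s H x = x ↑ˡ (s ℕ.* n H)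

leaf : ∀ s H → Fin (n (Edgeless s · H)) → Fin (n (Star s · H))
leaf s H i = n H ↑ʳ i

centre-or-leaf : ∀ s H y → (∃ λ x → centre s H x ≡ y) ⊎ (∃ λ i → leaf s H i ≡ y)
centre-or-leaf s H y with splitAt (n H) y in eq
... | inj₁ x = inj₁ (x , Fin.splitAt⁻¹-↑ˡ eq)
... | inj₂ i = inj₂ (i , Fin.splitAt⁻¹-↑ʳ eq)

lexAdj-independent : ∀ {s} (G₁ H : Graph) (σ : Fin s → Fin (n G₁)) →
  (∀ {q q′} → σ q ≡ σ q′ → q ≡ q′) → (∀ q q′ → adj G₁ (σ q) (σ q′) ≡ false) →
  ∀ (p p′ : Fin (n H) × Fin s) →
  lexAdjP G₁ H (swap (map₂ σ p)) (swap (map₂ σ p′)) ≡ lexAdjP (Edgeless s) H (swap p) (swap p′)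
lexAdj-independent G₁ H σ σ-injective σ-independent (r , q) (r′ , q′) rewrite σ-independent q q′ =
  cong (_∧ adj H r r′) (⌊⌋-⇔ (mk⇔ σ-injective (cong σ)) (σ q ≟ σ q′) (q ≟ q′))

adj-leaf : ∀ s H i j → adj (Edgeless s · H) i j ≡ adj (Star s · H) (leaf s H i) (leaf s H j)
adj-leaf s H i j rewrite Fin.splitAt-↑ʳ (n H) (s ℕ.* n H) i | Fin.splitAt-↑ʳ (n H) (s ℕ.* n H) j =
  sym (lexAdj-independent (Star s) H suc Fin.suc-injective (λ _ _ → refl)
         (quotRem (n H) i) (quotRem (n H) j))

adj-Edgeless-suc : ∀ s H i j → adj (H ⊕ (Edgeless s · H)) i j ≡ adj (Edgeless (suc s) · H) i j
adj-Edgeless-suc s H i j with splitAt (n H) i | splitAt (n H) j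
... | inj₁ _ | inj₁ _ = refl
... | inj₁ _ | inj₂ _ = refl
... | inj₂ _ | inj₁ _ = refl
... | inj₂ a | inj₂ b =
  sym (lexAdj-independent (Edgeless (suc s)) H suc Fin.suc-injective (λ _ _ → refl)
         (quotRem (n H) a) (quotRem (n H) b))

Edgeless·-∈ : ∀ {𝒢 : GraphClass} → MinorClosed 𝒢 → UnionClosed 𝒢 →
  ∀ {H} → 𝒢 H → ∀ s → 𝒢 (Edgeless s · H)
Edgeless·-∈ minor-closed union-closed 𝒢H zero = minor-closed _ _ 𝒢H
  record { branch = λ _ → nothing ; nonempty = λ () ; connected = λ () ; edges = λ () }
Edgeless·-∈ minor-closed union-closed {H} 𝒢H (suc s) =
  minor-closed _ _ (union-closed _ _ 𝒢H (Edgeless·-∈ minor-closed union-closed 𝒢H s))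
    (≼-restrict ≼-refl (λ i → i) (λ i≡j → i≡j) (adj-Edgeless-suc s H) (λ y _ → y , refl))

centre-free-≼ : ∀ {s H G} (φ : G ≼ (Star s · H)) →
  (∀ x → MinorModel.branch φ (centre s H x) ≡ nothing) → G ≼ (Edgeless s · H)
centre-free-≼ {s} {H} φ centre-free =
  ≼-restrict φ (leaf s H) (Fin.↑ʳ-injective (n H) _ _) (adj-leaf s H) leaf-covers
  where
  leaf-covers : ∀ y {v} → MinorModel.branch φ y ≡ just v → ∃ λ i → leaf s H i ≡ y
  leaf-covers y y∈v with centre-or-leaf s H y
  ... | inj₁ (x , refl) with () ← trans (sym (centre-free x)) y∈v
  ... | inj₂ l = l

module Bound (c : ℚ) (Δ : ℕ) (c≤Δ : c ℚ.≤ ℕ→ℚ Δ) where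

  bound : ℕ → ℕ → ℚ
  bound V m = c ℚ.* ℕ→ℚ V ℚ.+ (ℕ→ℚ Δ - c) ℚ.* ℕ→ℚ m

  private instance
    Δ-c-nonNeg : ℚ.NonNegative (ℕ→ℚ Δ - c)
    Δ-c-nonNeg = ℚ.nonNegative
      (subst (ℚ._≤ ℕ→ℚ Δ - c) (ℚ.+-inverseʳ c) (ℚ.+-monoˡ-≤ (ℚ.- c) c≤Δ))

  bound-monoʳ-≤ : ∀ V {m m′} → m ≤ m′ → bound V m ℚ.≤ bound V m′
  bound-monoʳ-≤ V m≤m′ =
    ℚ.+-monoʳ-≤ (c ℚ.* ℕ→ℚ V) (ℚ.*-monoˡ-≤-nonNeg (ℕ→ℚ Δ - c) (ℕ→ℚ-mono-≤ m≤m′))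

  cV≤bound : ∀ V m → c ℚ.* ℕ→ℚ V ℚ.≤ bound V m
  cV≤bound V m = ℚ.≤-trans (ℚ.≤-reflexive (sym bound-V-0)) (bound-monoʳ-≤ V {0} {m} z≤n)
    where
    bound-V-0 : bound V 0 ≡ c ℚ.* ℕ→ℚ V
    bound-V-0 = trans (cong (c ℚ.* ℕ→ℚ V ℚ.+_) (ℚ.*-zeroʳ (ℕ→ℚ Δ - c))) (ℚ.+-identityʳ _)

  0<bound : 0ℚ ℚ.< c → ∀ {V} m → 0 < V → 0ℚ ℚ.< bound V m
  0<bound 0<c {V} m 0<V = ℚ.<-≤-trans 0<cV (cV≤bound V m)
    where
    0<cV : 0ℚ ℚ.< c ℚ.* ℕ→ℚ V
    0<cV = subst (ℚ._< c ℚ.* ℕ→ℚ V) (ℚ.*-zeroʳ c)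
      (ℚ.*-monoʳ-<-pos c {{ℚ.positive 0<c}} (ℕ→ℚ-mono-< 0<V))

  bound-suc : ∀ V m → bound (suc V) (suc m) ≡ bound V m ℚ.+ ℕ→ℚ Δ
  bound-suc V m rewrite ℕ→ℚ-homo-+ 1 V | ℕ→ℚ-homo-+ 1 m =
    semiring-identity c (ℕ→ℚ Δ) (ℕ→ℚ V) (ℕ→ℚ m)
    where
    open ℚ-Solver.+-*-Solver
    semiring-identity : ∀ c D V m →
      c ℚ.* (1ℚ ℚ.+ V) ℚ.+ (D - c) ℚ.* (1ℚ ℚ.+ m) ≡ (c ℚ.* V ℚ.+ (D - c) ℚ.* m) ℚ.+ D
    semiring-identity = solve 4 (λ c D V m →
      c :* (con 1ℚ :+ V) :+ (D :- c) :* (con 1ℚ :+ m) := (c :* V :+ (D :- c) :* m) :+ D) refl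

  bound-step : ∀ V {m m′ E E′} → E ≤ E′ + Δ → ℕ→ℚ E′ ℚ.< bound V m′ → m′ < m →
    ℕ→ℚ E ℚ.< bound (suc V) m
  bound-step V {m} {m′} {E} {E′} E≤E′+Δ E′<bound m′<m = begin-strict
    ℕ→ℚ E                  ≤⟨ ℕ→ℚ-mono-≤ E≤E′+Δ ⟩
    ℕ→ℚ (E′ + Δ)           ≡⟨ ℕ→ℚ-homo-+ E′ Δ ⟩
    ℕ→ℚ E′ ℚ.+ ℕ→ℚ Δ       <⟨ ℚ.+-monoˡ-< (ℕ→ℚ Δ) E′<bound ⟩
    bound V m′ ℚ.+ ℕ→ℚ Δ   ≡⟨ bound-suc V m′ ⟨
    bound (suc V) (suc m′) ≤⟨ bound-monoʳ-≤ (suc V) m′<m ⟩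
    bound (suc V) m        ∎
    where open ℚ.≤-Reasoning

module _ {c : ℚ} {Δ : ℕ} (0<c : 0ℚ ℚ.< c) (c≤Δ : c ℚ.≤ ℕ→ℚ Δ)
         {𝒢 : GraphClass} (minor-closed : MinorClosed 𝒢) (union-closed : UnionClosed 𝒢)
         (sparse : ∀ H → 𝒢 H → 0 < ∣V∣ H → ℕ→ℚ (∣E∣ H) ℚ.< c ℚ.* ℕ→ℚ (∣V∣ H))
         {s : ℕ} {H : Graph} (𝒢H : 𝒢 H) where

  open Bound c Δ c≤Δ

  usedCentre : ∀ {G} → G ≼ (Star s · H) → ℕ
  usedCentre φ = branched φ (centre s H)

  star-minor-bound : ∀ k G → ∣V∣ G ≡ suc k → (∀ x → deg G x ≤ Δ) → (φ : G ≼ (Star s · H)) →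
    ℕ→ℚ (∣E∣ G) ℚ.< bound (∣V∣ G) (usedCentre φ)
  star-minor-bound zero G ∣V∣≡1 _ φ =
    subst (ℚ._< bound (∣V∣ G) (usedCentre φ)) (cong ℕ→ℚ (sym (∣V∣≡1⇒∣E∣≡0 G ∣V∣≡1)))
      (0<bound 0<c (usedCentre φ) (subst (0 <_) (sym ∣V∣≡1) (s≤s z≤n)))
  star-minor-bound (suc k) G ∣V∣≡2+k deg≤Δ φ
    with all-nothing-or-just (MinorModel.branch φ ∘ centre s H)
  ... | inj₁ centre-free =
    ℚ.<-≤-trans (sparse G 𝒢G (subst (0 <_) (sym ∣V∣≡2+k) (s≤s z≤n))) (cV≤bound (∣V∣ G) (usedCentre φ))
    where
    𝒢G : 𝒢 G
    𝒢G = minor-closed _ _ (Edgeless·-∈ minor-closed union-closed 𝒢H s) (centre-free-≼ φ centre-free)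
  ... | inj₂ (x , v , x∈v) =
    subst (λ V → ℕ→ℚ (∣E∣ G) ℚ.< bound V (usedCentre φ)) (∣V∣-∖ G v)
      (bound-step (∣V∣ (G ∖ v)) E≤E∖v+Δ IH (branched-∖ᴹ φ (centre s H) x x∈v))
    where
    E≤E∖v+Δ : ∣E∣ G ≤ ∣E∣ (G ∖ v) + Δ
    E≤E∖v+Δ = subst (_≤ ∣E∣ (G ∖ v) + Δ) (sym (∣E∣-∖ G v)) (ℕ.+-monoʳ-≤ (∣E∣ (G ∖ v)) (deg≤Δ v))
    IH : ℕ→ℚ (∣E∣ (G ∖ v)) ℚ.< bound (∣V∣ (G ∖ v)) (usedCentre (φ ∖ᴹ v))
    IH = star-minor-bound k (G ∖ v) (ℕ.suc-injective (trans (∣V∣-∖ G v) ∣V∣≡2+k))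
           (deg-∖-≤ G v deg≤Δ) (φ ∖ᴹ v)

lemma9 : (c : ℚ) (Δ : ℕ) → 0ℚ ℚ.< c → c ℚ.≤ ℕ→ℚ Δ →
    (𝒢 : GraphClass) → MinorClosed 𝒢 → UnionClosed 𝒢 →
    (∀ H → 𝒢 H → 0 < ∣V∣ H → ℕ→ℚ (∣E∣ H) ℚ.< c ℚ.* ℕ→ℚ (∣V∣ H)) →
    (s : ℕ) (H G : Graph) → 𝒢 H → MaxDegree G Δ → G ≼ (Star s · H) →
    ℕ→ℚ (∣E∣ G) ℚ.< c ℚ.* ℕ→ℚ (∣V∣ G) ℚ.+ (ℕ→ℚ Δ - c) ℚ.* ℕ→ℚ (∣V∣ H)
lemma9 c Δ 0<c c≤Δ 𝒢 minor-closed union-closed sparse s H G 𝒢H (deg≤Δ , x₀ , _) φ =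
  ℚ.<-≤-trans G-bound (bound-monoʳ-≤ (∣V∣ G) {branched φ (centre s H)} {∣V∣ H} (∑-count-≤ _))
  where
  open Bound c Δ c≤Δ
  ∣V∣≡suc : ∣V∣ G ≡ suc (ℕ.pred (∣V∣ G))
  ∣V∣≡suc = sym (ℕ.suc-pred (∣V∣ G) {{Fin.nonZeroIndex x₀}})
  G-bound : ℕ→ℚ (∣E∣ G) ℚ.< bound (∣V∣ G) (branched φ (centre s H))
  G-bound = star-minor-bound 0<c c≤Δ minor-closed union-closed sparse 𝒢H
              (ℕ.pred (∣V∣ G)) G ∣V∣≡suc deg≤Δ φ
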